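{- Let $G \in \mathcal{C}$, let $S$ be a minimal separator of $G$ with distinct full components $L, R$, and let $Z \subseteq L$, $Z' \subseteq R$, $f$, $g$ be as described in the context, with $|Z|,|Z'| \ge 2$. Let $W$, profiles, $L$-/$R$-ambiguity and the measuring sets $Z_L, Z_R$ be as defined in the context. If $x \in S$ and $N(x) \cap W$ is an $R$-ambiguous profile, then $x$ has a neighbor in $Z_L \cap L$. Similarly, if $x \in S$ and $N(x) \cap W$ is an $L$-ambiguous profile, then $x$ has a neighbor in $Z_R \cap R$.
   Context: $\mathcal{C}$ is the class of graphs with no induced cycle of length at least $6$ and no induced extended $C_5$ (a five-vertex induced cycle plus a vertex adjacent to exactly one or exactly two consecutive of its vertices). $N(X)$ is the open neighborhood. A minimal separator $S$ is a set such that $G-S$ has at least two components $D$ with $N(D)=S$ (full components). Setting: $Z \subseteq L$ is a clique with $S \subseteq N(Z)$ and $(N(z)\cap S)\setminus N(Z\setminus\{z\}) \ne \emptyset$ for all $z \in Z$; $Z' \subseteq R$ is a clique with the analogous properties. For $z \in Z$, $f(z) \in (N(z)\cap S)\setminus N(Z\setminus\{z\})$ and $g(z)$ is a neighbor of $f(z)$ in $R$; for $z \in Z'$, $f(z)\in (N(z)\cap S)\setminus N(Z'\setminus\{z\})$ and $g(z)$ is a neighbor of $f(z)$ in $L$. Choose distinct $a_1,a_2 \in Z$ and put $b_i=f(a_i)$, $r_i=g(a_i)$; choose distinct $d_1,d_2 \in Z'$ and put $c_i=f(d_i)$, $l_i=g(d_i)$ ($i=1,2$). Let $W=\{a_1,a_2,b_1,b_2,r_1,r_2,c_1,c_2,d_1,d_2,l_1,l_2\}$.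 A profile is a subset $T\subseteq W$ meeting each of $\{a_1,b_1,r_1\},\{a_2,b_2,r_2\},\{c_1,d_1,l_1\},\{c_2,d_2,l_2\}$. A profile $T$ is $L$-ambiguous if $T\subseteq\{a_1,a_2,b_1,b_2,c_1,c_2,l_1,l_2\}$ and $R$-ambiguous if $T \subseteq \{b_1,b_2,c_1,c_2,d_1,d_2,r_1,r_2\}$. $Z_R$ is the set of vertices complete to $\{d_1,d_2\}$ and anticomplete to $\{c_1,c_2,l_1,l_2\}$; $Z_L$ is the set of vertices complete to $\{a_1,a_2\}$ and anticomplete to $\{b_1,b_2,r_1,r_2\}$. -}

module Defs where

open import Data.Nat using (ℕ; zero; suc; _≤_)
open import Data.Fin using (Fin; toℕ)
open import Data.Fin.Subset using (Subset; _∈_; _∉_; Nonempty)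
open import Data.Product using (Σ; ∃; ∃-syntax; _×_; _,_)
open import Data.Sum using (_⊎_)
open import Data.List using (List; []; _∷_)
import Data.List.Membership.Propositional as LM
open import Data.List.Relation.Unary.Any using (Any)
open import Relation.Nullary using (¬_; Dec)
open import Relation.Binary.PropositionalEquality using (_≡_; _≢_)
open import Function.Bundles using (_⇔_)
open import Function.Definitions using (Injective)

record Graph : Set₁ where
  field
    n      : ℕ
    E      : Fin n → Fin n → Set
    E-dec  : ∀ u v → Dec (E u v)
    E-sym  : ∀ {u v} → E u v → E v u
    E-irr  : ∀ v → ¬ E v v

module _ (G : Graph) where
  open Graph G

  V : Set
  V = Fin n

  CycSucc : ∀ {m} → Fin (suc m) → Fin (suc m) → Set
  CycSucc {m} i j = (toℕ j ≡ suc (toℕ i)) ⊎ (toℕ i ≡ m × toℕ j ≡ 0)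

  CycAdj : ∀ {m} → Fin (suc m) → Fin (suc m) → Set
  CycAdj i j = CycSucc i j ⊎ CycSucc j i

  -- c is an induced cycle of length suc m (vertices c 0, ..., c m in cyclic order)
  InducedCycle : (m : ℕ) → (Fin (suc m) → V) → Set
  InducedCycle m c = Injective _≡_ _≡_ c × (∀ i j → E (c i) (c j) ⇔ CycAdj i j)

  HasLongHole : Set
  HasLongHole = ∃[ m ] (5 ≤ m × ∃[ c ] InducedCycle m c)

  HasExtendedC5 : Set
  HasExtendedC5 =
    ∃[ c ] (InducedCycle 4 c × ∃[ v ] ((∀ i → v ≢ c i) ×
       ((∃[ i ] (∀ j → E v (c j) ⇔ (j ≡ i)))
        ⊎ (∃[ i ] (∀ j → E v (c j) ⇔ (j ≡ i ⊎ CycSucc i j))))))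

  InC : Set
  InC = ¬ HasLongHole × ¬ HasExtendedC5

  InN : Subset n → V → Set
  InN X v = v ∉ X × ∃[ u ] (u ∈ X × E u v)

  data WalkIn (D : Subset n) : V → V → Set where
    here : ∀ {u} → u ∈ D → WalkIn D u u
    step : ∀ {u w v} → u ∈ D → E u w → WalkIn D w v → WalkIn D u v

  IsComponent : Subset n → Subset n → Set
  IsComponent S D =
    Nonempty D
    × (∀ v → v ∈ D → v ∉ S)
    × (∀ u v → u ∈ D → v ∈ D → WalkIn D u v)
    × (∀ u v → u ∈ D → v ∉ S → E u v → v ∈ D)

  IsFullComponent : Subset n → Subset n → Set
  IsFullComponent S D = IsComponent S D × (∀ v → InN D v ⇔ v ∈ S)

  IsMinimalSeparator : Subset n → Set
  IsMinimalSeparator S =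
    ∃[ D₁ ] ∃[ D₂ ] (IsFullComponent S D₁ × IsFullComponent S D₂ × D₁ ≢ D₂)

  IsClique : Subset n → Set
  IsClique Z = ∀ u v → u ∈ Z → v ∈ Z → u ≢ v → E u v

  GoodClique : Subset n → Subset n → Subset n → Set
  GoodClique S D Z =
    (∀ z → z ∈ Z → z ∈ D) × IsClique Z × (∀ s → s ∈ S → InN Z s)
    × (∀ z → z ∈ Z → ∃[ s ] (s ∈ S × E z s × (∀ z' → z' ∈ Z → z' ≢ z → ¬ E z' s)))

  GoodFG : Subset n → Subset n → Subset n → (V → V) → (V → V) → Set
  GoodFG S Z D f g =
    ∀ z → z ∈ Z →
      f z ∈ S × E z (f z) × (∀ z' → z' ∈ Z → z' ≢ z → ¬ E z' (f z))
      × g z ∈ D × E (f z) (g z)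

  NMeets : V → List V → Set
  NMeets x B = Any (E x) B

  NWithin : V → List V → List V → Set
  NWithin x W A = ∀ v → v LM.∈ W → E x v → v LM.∈ A

  Complete : V → List V → Set
  Complete y A = ∀ v → v LM.∈ A → E y v

  Anticomplete : V → List V → Set
  Anticomplete y A = ∀ v → v LM.∈ A → ¬ E y v

  -- N(x) ∩ W is a profile: it meets each of the four triples
  -- (containment in W is automatic)
  NIsProfile : V → (a₁ a₂ b₁ b₂ r₁ r₂ c₁ c₂ d₁ d₂ l₁ l₂ : V) → Set
  NIsProfile x a₁ a₂ b₁ b₂ r₁ r₂ c₁ c₂ d₁ d₂ l₁ l₂ =
    NMeets x (a₁ ∷ b₁ ∷ r₁ ∷ []) × NMeets x (a₂ ∷ b₂ ∷ r₂ ∷ [])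
    × NMeets x (c₁ ∷ d₁ ∷ l₁ ∷ []) × NMeets x (c₂ ∷ d₂ ∷ l₂ ∷ [])

  Wlist : (a₁ a₂ b₁ b₂ r₁ r₂ c₁ c₂ d₁ d₂ l₁ l₂ : V) → List V
  Wlist a₁ a₂ b₁ b₂ r₁ r₂ c₁ c₂ d₁ d₂ l₁ l₂ =
    a₁ ∷ a₂ ∷ b₁ ∷ b₂ ∷ r₁ ∷ r₂ ∷ c₁ ∷ c₂ ∷ d₁ ∷ d₂ ∷ l₁ ∷ l₂ ∷ []

-- The measuring vertex is simply a neighbour z of x in the clique Z (it exists since
-- S ⊆ N(Z)). If N(x) ∩ W is R-ambiguous, x misses a₁ and a₂, so z ≠ a₁, a₂. Then z is
-- adjacent to a₁, a₂ because Z is a clique, misses f(a₁), f(a₂) because these are private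
-- neighbours of a₁, a₂, and misses g(a₁), g(a₂) ∈ R because no edge joins two distinct
-- components of G - S. The L-ambiguous case is the same argument with L and R swapped.
module Submission where

open import Defs
open import Data.Fin.Subset using (Subset; _∈_; _∉_)
open import Data.Fin.Subset.Properties using (⊆-antisym)
open import Data.Product using (_×_; ∃-syntax; _,_)
open import Data.List using (_∷_; [])
import Data.List.Membership.Propositional as List
open import Data.List.Relation.Unary.All using (All; _∷_; []; lookup)
open import Data.List.Relation.Unary.Any using (here; there)
open import Relation.Nullary using (¬_)
open import Function using (_∘_)
open import Relation.Binary.PropositionalEquality using (_≡_; _≢_; refl; ≢-sym)

module _ {G : Graph} where
  open Graph G

  walkIn-head : ∀ {D u v} → WalkIn G D u v → u ∈ D
  walkIn-head (here u∈D)     = u∈D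
  walkIn-head (step u∈D _ _) = u∈D

  walkIn-preserves-component : ∀ {S D D′ u v} → IsComponent G S D → IsComponent G S D′ →
                               WalkIn G D u v → u ∈ D′ → v ∈ D′
  walkIn-preserves-component _ _ (here _) u∈D′ = u∈D′
  walkIn-preserves-component cD@(_ , D∩S=∅ , _) cD′@(_ , _ , _ , closed′)
                             (step {u} {w} _ uw walk) u∈D′ =
    walkIn-preserves-component cD cD′ walk
      (closed′ u w u∈D′ (D∩S=∅ w (walkIn-head walk)) uw)

  components-meet⇒≡ : ∀ {S D D′ v} → IsComponent G S D → IsComponent G S D′ →
                      v ∈ D → v ∈ D′ → D ≡ D′
  components-meet⇒≡ cD@(_ , _ , connected , _) cD′@(_ , _ , connected′ , _) v∈D v∈D′ =
    ⊆-antisym (λ w∈D  → walkIn-preserves-component cD cD′ (connected _ _ v∈D w∈D) v∈D′)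
              (λ w∈D′ → walkIn-preserves-component cD′ cD (connected′ _ _ v∈D′ w∈D′) v∈D)

  distinct-components-disjoint : ∀ {S D D′ v} → IsComponent G S D → IsComponent G S D′ →
                                 D ≢ D′ → v ∈ D → v ∉ D′
  distinct-components-disjoint cD cD′ D≢D′ v∈D v∈D′ = D≢D′ (components-meet⇒≡ cD cD′ v∈D v∈D′)

  components-adjacent⇒≡ : ∀ {S D D′ u v} → IsComponent G S D → IsComponent G S D′ →
                          u ∈ D → v ∈ D′ → E u v → D ≡ D′
  components-adjacent⇒≡ cD@(_ , _ , _ , closed) cD′@(_ , D′∩S=∅ , _) u∈D v∈D′ uv =
    components-meet⇒≡ cD cD′ (closed _ _ u∈D (D′∩S=∅ _ v∈D′) uv) v∈D′

  NWithin-avoids : ∀ {x W A D v} → NWithin G x W A → All (_∉ D) A →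
                   v List.∈ W → v ∈ D → ¬ E x v
  NWithin-avoids within A∩D=∅ v∈W v∈D xv = lookup A∩D=∅ (within _ v∈W xv) v∈D

  clique-member-measures : ∀ {S L R Z f g z a} →
    IsComponent G S L → IsComponent G S R → L ≢ R →
    GoodClique G S L Z → GoodFG G S Z R f g →
    z ∈ Z → a ∈ Z → z ≢ a → E z a × ¬ E z (f a) × ¬ E z (g a)
  clique-member-measures cL cR L≢R (Z⊆L , clique , _) fg z∈Z a∈Z z≢a
    with fg _ a∈Z
  ... | _ , _ , fa-private , ga∈R , _ =
      clique _ _ z∈Z a∈Z z≢a
    , fa-private _ z∈Z z≢a
    , λ z~ga → L≢R (components-adjacent⇒≡ cL cR (Z⊆L _ z∈Z) ga∈R z~ga)

  neighbour-in-Z-measures : ∀ {S L R Z f g a₁ a₂ x} →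
    IsComponent G S L → IsComponent G S R → L ≢ R →
    GoodClique G S L Z → GoodFG G S Z R f g →
    a₁ ∈ Z → a₂ ∈ Z → x ∈ S → ¬ E x a₁ → ¬ E x a₂ →
    ∃[ y ] (y ∈ L × Complete G y (a₁ ∷ a₂ ∷ [])
                  × Anticomplete G y (f a₁ ∷ f a₂ ∷ g a₁ ∷ g a₂ ∷ [])
                  × E x y)
  neighbour-in-Z-measures {f = f} {g} {a₁} {a₂} {x}
                          cL cR L≢R good@(Z⊆L , _ , S⊆N[Z] , _) fg a₁∈Z a₂∈Z x∈S x≁a₁ x≁a₂
    with S⊆N[Z] _ x∈S
  ... | _ , z , z∈Z , zx = z , Z⊆L z z∈Z , complete , anticomplete , E-sym zx
    where
      z≢ : ∀ {a} → ¬ E x a → z ≢ a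
      z≢ x≁a refl = x≁a (E-sym zx)

      measures₁ : E z a₁ × ¬ E z (f a₁) × ¬ E z (g a₁)
      measures₁ = clique-member-measures cL cR L≢R good fg z∈Z a₁∈Z (z≢ x≁a₁)

      measures₂ : E z a₂ × ¬ E z (f a₂) × ¬ E z (g a₂)
      measures₂ = clique-member-measures cL cR L≢R good fg z∈Z a₂∈Z (z≢ x≁a₂)

      complete : Complete G z (a₁ ∷ a₂ ∷ [])
      complete _ (here refl)         = let z~a₁ , _ = measures₁ in z~a₁
      complete _ (there (here refl)) = let z~a₂ , _ = measures₂ in z~a₂

      anticomplete : Anticomplete G z (f a₁ ∷ f a₂ ∷ g a₁ ∷ g a₂ ∷ [])
      anticomplete _ (here refl)                         = let _ , z≁fa₁ , _ = measures₁ in z≁fa₁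
      anticomplete _ (there (here refl))                 = let _ , z≁fa₂ , _ = measures₂ in z≁fa₂
      anticomplete _ (there (there (here refl)))         = let _ , _ , z≁ga₁ = measures₁ in z≁ga₁
      anticomplete _ (there (there (there (here refl)))) = let _ , _ , z≁ga₂ = measures₂ in z≁ga₂

lemma3p5 :
    (G : Graph) → InC G →
    (S L R : Subset (Graph.n G)) →
    IsMinimalSeparator G S →
    IsFullComponent G S L → IsFullComponent G S R → L ≢ R →
    (Z Z' : Subset (Graph.n G)) →
    GoodClique G S L Z → GoodClique G S R Z' →
    (f g : V G → V G) →
    GoodFG G S Z R f g → GoodFG G S Z' L f g →
    (a₁ a₂ d₁ d₂ : V G) →
    a₁ ∈ Z → a₂ ∈ Z → a₁ ≢ a₂ → d₁ ∈ Z' → d₂ ∈ Z' → d₁ ≢ d₂ →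
    (∀ x → x ∈ S →
       NIsProfile G x a₁ a₂ (f a₁) (f a₂) (g a₁) (g a₂) (f d₁) (f d₂) d₁ d₂ (g d₁) (g d₂) →
       NWithin G x (Wlist G a₁ a₂ (f a₁) (f a₂) (g a₁) (g a₂) (f d₁) (f d₂) d₁ d₂ (g d₁) (g d₂)) ((f a₁) ∷ (f a₂) ∷ (f d₁) ∷ (f d₂) ∷ d₁ ∷ d₂ ∷ (g a₁) ∷ (g a₂) ∷ []) →
       ∃[ y ] (y ∈ L × Complete G y (a₁ ∷ a₂ ∷ [])
                × Anticomplete G y ((f a₁) ∷ (f a₂) ∷ (g a₁) ∷ (g a₂) ∷ [])
                × Graph.E G x y))
    ×
    (∀ x → x ∈ S →
       NIsProfile G x a₁ a₂ (f a₁) (f a₂) (g a₁) (g a₂) (f d₁) (f d₂) d₁ d₂ (g d₁) (g d₂) →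
       NWithin G x (Wlist G a₁ a₂ (f a₁) (f a₂) (g a₁) (g a₂) (f d₁) (f d₂) d₁ d₂ (g d₁) (g d₂)) (a₁ ∷ a₂ ∷ (f a₁) ∷ (f a₂) ∷ (f d₁) ∷ (f d₂) ∷ (g d₁) ∷ (g d₂) ∷ []) →
       ∃[ y ] (y ∈ R × Complete G y (d₁ ∷ d₂ ∷ [])
                × Anticomplete G y ((f d₁) ∷ (f d₂) ∷ (g d₁) ∷ (g d₂) ∷ [])
                × Graph.E G x y))
lemma3p5 G _ S L R _ (cL@(_ , L∩S=∅ , _) , _) (cR@(_ , R∩S=∅ , _) , _) L≢R Z Z'
         goodZ@(Z⊆L , _) goodZ'@(Z'⊆R , _) f g fgZ fgZ' a₁ a₂ d₁ d₂ a₁∈Z a₂∈Z _ d₁∈Z' d₂∈Z' _ =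
    (λ x x∈S _ within →
       neighbour-in-Z-measures cL cR L≢R goodZ fgZ a₁∈Z a₂∈Z x∈S
         (NWithin-avoids {G = G} within outside-L (here refl) (Z⊆L _ a₁∈Z))
         (NWithin-avoids {G = G} within outside-L (there (here refl)) (Z⊆L _ a₂∈Z)))
  , (λ x x∈S _ within →
       neighbour-in-Z-measures cR cL (≢-sym L≢R) goodZ' fgZ' d₁∈Z' d₂∈Z' x∈S
         (NWithin-avoids {G = G} within outside-R (there⁸ (here refl)) (Z'⊆R _ d₁∈Z'))
         (NWithin-avoids {G = G} within outside-R (there⁸ (there (here refl))) (Z'⊆R _ d₂∈Z')))
  where
    f∈S : ∀ {Y D y} → GoodFG G S Y D f g → y ∈ Y → f y ∈ S
    f∈S fg y∈Y = let fy∈S , _ = fg _ y∈Y in fy∈S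

    g∈ : ∀ {Y D y} → GoodFG G S Y D f g → y ∈ Y → g y ∈ D
    g∈ fg y∈Y = let _ , _ , _ , gy∈D , _ = fg _ y∈Y in gy∈D

    S∉L : ∀ {v} → v ∈ S → v ∉ L
    S∉L v∈S v∈L = L∩S=∅ _ v∈L v∈S

    S∉R : ∀ {v} → v ∈ S → v ∉ R
    S∉R v∈S v∈R = R∩S=∅ _ v∈R v∈S

    R∉L : ∀ {v} → v ∈ R → v ∉ L
    R∉L = distinct-components-disjoint cR cL (≢-sym L≢R)

    L∉R : ∀ {v} → v ∈ L → v ∉ R
    L∉R = distinct-components-disjoint cL cR L≢R

    outside-L : All (_∉ L) (f a₁ ∷ f a₂ ∷ f d₁ ∷ f d₂ ∷ d₁ ∷ d₂ ∷ g a₁ ∷ g a₂ ∷ [])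
    outside-L = S∉L (f∈S fgZ a₁∈Z) ∷ S∉L (f∈S fgZ a₂∈Z) ∷ S∉L (f∈S fgZ' d₁∈Z') ∷ S∉L (f∈S fgZ' d₂∈Z')
              ∷ R∉L (Z'⊆R _ d₁∈Z') ∷ R∉L (Z'⊆R _ d₂∈Z') ∷ R∉L (g∈ fgZ a₁∈Z) ∷ R∉L (g∈ fgZ a₂∈Z) ∷ []

    outside-R : All (_∉ R) (a₁ ∷ a₂ ∷ f a₁ ∷ f a₂ ∷ f d₁ ∷ f d₂ ∷ g d₁ ∷ g d₂ ∷ [])
    outside-R = L∉R (Z⊆L _ a₁∈Z) ∷ L∉R (Z⊆L _ a₂∈Z) ∷ S∉R (f∈S fgZ a₁∈Z) ∷ S∉R (f∈S fgZ a₂∈Z)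
              ∷ S∉R (f∈S fgZ' d₁∈Z') ∷ S∉R (f∈S fgZ' d₂∈Z') ∷ L∉R (g∈ fgZ' d₁∈Z') ∷ L∉R (g∈ fgZ' d₂∈Z') ∷ []

    -- d₁ sits at position 8 of W.
    there⁸ : ∀ {v : V G} {xs} → v List.∈ xs → v List.∈ (a₁ ∷ a₂ ∷ f a₁ ∷ f a₂ ∷ g a₁ ∷ g a₂ ∷ f d₁ ∷ f d₂ ∷ xs)
    there⁸ = there ∘ there ∘ there ∘ there ∘ there ∘ there ∘ there ∘ there
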